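{- Let $\Gamma=(X,\ast,t)$ be a pregeometry with type set $I$ all of whose rank 2 truncations are connected, and let $G\leq \operatorname{Aut}\Gamma$ be transitive on $X_i$ for every $i\in I$. Suppose that $\Gamma$ is $G$-primitive-basic. Then $\Gamma$ admits a unique decomposition $\Gamma=\Gamma_1\oplus\cdots\oplus\Gamma_\ell$ where, for each $i$, $\Gamma_i$ is indecomposable and the group $G^{\Gamma_i}$ induced by $G$ on the element set of $\Gamma_i$ is faithful and primitive on the set of elements of each type of $\Gamma_i$.
   Context: A pregeometry $\Gamma=(X,\ast,t)$ consists of a finite set $X$ of elements, a symmetric reflexive relation $\ast$ on $X$ (incidence), and a surjection $t:X\to I$ onto a set $I$ of types, such that if $x\ast y$ and $x\neq y$ then $t(x)\neq t(y)$. Write $X_i=t^{ -1}(i)$. For nonempty $J\subseteq I$, the $J$-truncation $\Gamma_J$ has element set $t^{ -1}(J)$ with the restricted incidence and type map. The incidence graph has vertex set $X$ and edges $\{x,y\}$ with $x\ast y$, $t(x)\ne t(y)$; "all rank 2 truncations connected" means that for all distinct $i,j\in I$ the incidence graph of $\Gamma_{\{i,j\}}$ is connected. An automorphism is a permutation $g$ of $X$ with $t(x^g)=t(x)$ and $x^g\ast y^g\iff x\ast y$. For a group $G$ acting on $Y$, $G^Y$ denotes the induced permutation group; the action is faithful if its kernel is trivial. $\Gamma$ is $G$-primitive-basic if $|X_i|\geq 2$ for every $i\in I$ and $G^{X_i}$ is primitive on $X_i$ for every $i\in I$. Direct sum: if $\Gamma_1,\Gamma_2$ are pregeometries with disjoint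 element sets and disjoint type sets, $\Gamma_1\oplus\Gamma_2$ has element set and type set the disjoint unions, restricts to $\Gamma_1$ and $\Gamma_2$ on their element sets, and every element of $\Gamma_1$ is incident with every element of $\Gamma_2$. Writing $\Gamma=\Gamma_1\oplus\cdots\oplus\Gamma_\ell$ means $I$ is partitioned into $I_1,\dots,I_\ell$ with $\Gamma_i$ the $I_i$-truncation and elements of types in different parts always incident. $\Gamma$ is decomposable if $\Gamma=\Gamma_1\oplus\Gamma_2$ for some (nonempty) $\Gamma_1,\Gamma_2$, and indecomposable otherwise. -}

module Defs where

open import Data.Nat using (ℕ)
open import Data.Fin using (Fin)
open import Data.Bool using (Bool; true)
open import Data.Product using (Σ; ∃; ∃₂; _×_; _,_)
open import Data.Sum using (_⊎_)
open import Data.Fin.Subset using (Subset; _∈_; _∉_)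
open import Data.Fin.Permutation using (Permutation′; _⟨$⟩ʳ_; _∘ₚ_; flip; _≈_)
import Data.Fin.Permutation as P
open import Relation.Binary.PropositionalEquality using (_≡_; _≢_)
open import Relation.Nullary using (¬_)
open import Function.Bundles using (_⇔_)

-- Pregeometry Γ = (X, *, t) with X = Fin n (elements) and I = Fin m (types).
-- The incidence relation on the finite set X is given by its characteristic
-- function; x * y holds iff inc x y ≡ true.

record Pregeometry (n m : ℕ) : Set where
  field
    t       : Fin n → Fin m
    t-surj  : ∀ (i : Fin m) → ∃ λ (x : Fin n) → t x ≡ i
    inc     : Fin n → Fin n → Bool
    inc-refl : ∀ x → inc x x ≡ true
    inc-sym  : ∀ x y → inc x y ≡ inc y x
    inc-typed : ∀ x y → inc x y ≡ true → x ≢ y → t x ≢ t y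

module _ {n m : ℕ} (Γ : Pregeometry n m) where
  open Pregeometry Γ

  _*_ : Fin n → Fin n → Set
  x * y = inc x y ≡ true

  -- walks in the incidence graph of the {i,j}-truncation starting at x:
  -- every vertex after the first has type i or j (the first vertex's type
  -- is constrained where Walk is used), edges join incident elements of
  -- distinct types.
  data Walk (i j : Fin m) : Fin n → Fin n → Set where
    here : ∀ {x} → Walk i j x x
    step : ∀ {x y z} → x * y → t x ≢ t y → (t y ≡ i ⊎ t y ≡ j) →
           Walk i j y z → Walk i j x z

  AllRank2Connected : Set
  AllRank2Connected = ∀ (i j : Fin m) → i ≢ j → ∀ (x y : Fin n) →
    (t x ≡ i ⊎ t x ≡ j) → (t y ≡ i ⊎ t y ≡ j) → Walk i j x y

  IsAutomorphism : Permutation′ n → Set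
  IsAutomorphism g =
    (∀ x → t (g ⟨$⟩ʳ x) ≡ t x) ×
    (∀ x y → inc (g ⟨$⟩ʳ x) (g ⟨$⟩ʳ y) ≡ inc x y)

  record IsAutSubgroup (G : Permutation′ n → Set) : Set where
    field
      aut   : ∀ g → G g → IsAutomorphism g
      resp  : ∀ g h → g ≈ h → G g → G h
      id∈   : G P.id
      comp∈ : ∀ g h → G g → G h → G (g ∘ₚ h)
      inv∈  : ∀ g → G g → G (flip g)

  module _ (G : Permutation′ n → Set) where

    TransitiveOn : Fin m → Set
    TransitiveOn i = ∀ x y → t x ≡ i → t y ≡ i →
      ∃ λ g → G g × g ⟨$⟩ʳ x ≡ y

    IsBlock : Fin m → Subset n → Set
    IsBlock i B =
      (∀ x → x ∈ B → t x ≡ i) ×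
      (∃ λ x → x ∈ B) ×
      (∀ g → G g →
         (∀ x → (x ∈ B ⇔ g ⟨$⟩ʳ x ∈ B)) ⊎ (∀ x → x ∈ B → g ⟨$⟩ʳ x ∉ B))

    TrivialBlock : Fin m → Subset n → Set
    TrivialBlock i B =
      (∀ x y → x ∈ B → y ∈ B → x ≡ y) ⊎ (∀ x → t x ≡ i → x ∈ B)

    PrimitiveOn : Fin m → Set
    PrimitiveOn i = TransitiveOn i × (∀ B → IsBlock i B → TrivialBlock i B)

    PrimitiveBasic : Set
    PrimitiveBasic = ∀ i →
      (∃₂ λ x y → t x ≡ i × t y ≡ i × x ≢ y) × PrimitiveOn i

  Decomposable : (Fin m → Set) → Set
  Decomposable J = ∃ λ (A : Subset m) →
    (∃ λ i → J i × i ∈ A) × (∃ λ j → J j × j ∉ A) ×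
    (∀ x y → J (t x) → J (t y) → t x ∈ A → t y ∉ A → x * y)

  Indecomposable : (Fin m → Set) → Set
  Indecomposable J = ¬ Decomposable J

  -- A decomposition Γ = Γ_1 ⊕ ... ⊕ Γ_ℓ, given by the surjective labelling
  -- p : I → Fin ℓ of types by parts (I_k = p⁻¹(k)), such that elements of
  -- types in different parts are always incident.
  IsDecomposition : (ℓ : ℕ) → (Fin m → Fin ℓ) → Set
  IsDecomposition ℓ p =
    (∀ k → ∃ λ i → p i ≡ k) ×
    (∀ x y → p (t x) ≢ p (t y) → x * y)

  GoodDecomposition : (G : Permutation′ n → Set) → (ℓ : ℕ) → (Fin m → Fin ℓ) → Set
  GoodDecomposition G ℓ p =
    IsDecomposition ℓ p ×
    (∀ k → Indecomposable (λ i → p i ≡ k)) ×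
    (∀ j →
       -- faithful: an element of G fixing X_j pointwise acts trivially on
       -- the element set of the summand containing type j
       (∀ g → G g → (∀ x → t x ≡ j → g ⟨$⟩ʳ x ≡ x) →
          ∀ y → p (t y) ≡ p j → g ⟨$⟩ʳ y ≡ y) ×
       -- primitive (blocks of G^{Γ_k} on X_j are exactly blocks of G on X_j)
       PrimitiveOn G j)

-- Call two types a, b non-incident if some element of type a is not incident with
-- some element of type b.  The summands of any decomposition are unions of classes of
-- the equivalence closure of this relation, and the classes themselves form a
-- decomposition into indecomposable summands; this gives existence and uniqueness.
-- Faithfulness: let g ∈ G fix X_a pointwise and let a, b be non-incident.  For u of
-- type b, the elements of type b with the same a-neighbours as u form a block of G on
-- X_b.  It is not all of X_b, for then an element of type a non-incident with one
-- element of X_b would be non-incident with all of X_b, contradicting connectivity of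
-- the {a,b}-truncation; so it is {u}, and since g preserves the a-neighbours of u,
-- g fixes u.  Hence the set of types fixed pointwise by g is closed under the relation.
module Submission where

open import Defs
open import Level using (0ℓ)
open import Data.Nat using (ℕ; zero; suc)
open import Data.Fin using (Fin; zero; suc; _≟_)
open import Data.Fin.Properties using (any?; all?; suc-injective)
open import Data.Bool using (true)
import Data.Bool.Properties as Bool
open import Data.Product using (∃; ∃₂; _×_; _,_; proj₁; proj₂)
open import Data.Sum using (_⊎_; inj₁; inj₂; [_,_]′)
open import Data.Empty using (⊥; ⊥-elim)
open import Data.List using (List; []; _∷_; cartesianProduct; allFin)
open import Data.List.Membership.Propositional using () renaming (_∈_ to _∈ₗ_)
open import Data.List.Relation.Unary.Any using (here; there)
open import Data.List.Membership.Propositional.Properties using (∈-cartesianProduct⁺; ∈-allFin)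
open import Data.Vec using (tabulate)
open import Data.Vec.Properties using (lookup∘tabulate; lookup⇒[]=; []=⇒lookup)
open import Data.Fin.Subset using (Subset; _∈_; _∉_)
open import Data.Fin.Subset.Properties using (_∈?_)
open import Data.Fin.Permutation using (Permutation′; _⟨$⟩ʳ_; _⟨$⟩ˡ_; inverseʳ)
open import Function.Base using (id; _∘_; const)
open import Function.Bundles using (_⇔_; mk⇔; Equivalence)
import Function.Properties.Equivalence as ⇔
open import Relation.Binary.Core using (Rel)
open import Relation.Binary.Definitions using (Decidable; Symmetric; _Respects_)
open import Relation.Binary.Construct.Closure.Equivalence using (EqClosure; gfold; symmetric; return)
open import Relation.Binary.Construct.Closure.ReflexiveTransitive using (ε; _◅◅_)
open import Relation.Binary.PropositionalEquality
  using (_≡_; _≢_; refl; sym; trans; cong; subst₂; isEquivalence; module ≡-Reasoning)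
open import Relation.Nullary using (¬_; Dec; yes; no; ¬?)
open import Relation.Nullary.Decidable using (_×-dec_; _→-dec_; isYes; decidable-stable; toWitness; fromWitness)
import Relation.Unary as U

open Equivalence using (to; from)

subset : ∀ {n p} {P : U.Pred (Fin n) p} → U.Decidable P → Subset n
subset P? = tabulate (isYes ∘ P?)

∈-subset : ∀ {n p} {P : U.Pred (Fin n) p} (P? : U.Decidable P) {x} → x ∈ subset P? ⇔ P x
∈-subset P? {x} = mk⇔
  (λ x∈ → toWitness (from Bool.T-≡ (trans (sym (lookup∘tabulate (isYes ∘ P?) x)) ([]=⇒lookup x∈))))
  (λ Px → lookup⇒[]= x (subset P?)
     (trans (lookup∘tabulate (isYes ∘ P?) x) (to Bool.T-≡ (fromWitness Px))))

coimage : ∀ {m k} (h : Fin m → Fin k) → ∃₂ λ ℓ (p : Fin m → Fin ℓ) →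
  (∀ c → ∃ λ i → p i ≡ c) × (∀ i j → p i ≡ p j ⇔ h i ≡ h j)
coimage {zero} h = 0 , (λ ()) , (λ ()) , (λ ())
coimage {suc m} h with coimage (h ∘ suc) | any? (λ i → h zero ≟ h (suc i))
... | ℓ , p , onto , ker | yes (i₀ , h₀≡) = ℓ , p ∘ σ , onto′ , ker′
  where
  σ : Fin (suc m) → Fin m
  σ zero = i₀
  σ (suc i) = i
  h∘suc∘σ : ∀ i → h (suc (σ i)) ≡ h i
  h∘suc∘σ zero = sym h₀≡
  h∘suc∘σ (suc i) = refl
  onto′ : ∀ c → ∃ λ i → p (σ i) ≡ c
  onto′ c = suc (proj₁ (onto c)) , proj₂ (onto c)
  ker′ : ∀ i j → p (σ i) ≡ p (σ j) ⇔ h i ≡ h j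
  ker′ i j = subst₂ (λ u v → p (σ i) ≡ p (σ j) ⇔ u ≡ v) (h∘suc∘σ i) (h∘suc∘σ j)
               (ker (σ i) (σ j))
... | ℓ , p , onto , ker | no fresh = suc ℓ , q , onto′ , ker′
  where
  q : Fin (suc m) → Fin (suc ℓ)
  q zero = zero
  q (suc i) = suc (p i)
  onto′ : ∀ c → ∃ λ i → q i ≡ c
  onto′ zero = zero , refl
  onto′ (suc c) = suc (proj₁ (onto c)) , cong suc (proj₂ (onto c))
  ker′ : ∀ i j → q i ≡ q j ⇔ h i ≡ h j
  ker′ zero zero = mk⇔ (const refl) (const refl)
  ker′ zero (suc j) = mk⇔ (λ ()) (λ e → ⊥-elim (fresh (j , e)))
  ker′ (suc i) zero = mk⇔ (λ ()) (λ e → ⊥-elim (fresh (i , sym e)))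
  ker′ (suc i) (suc j) = mk⇔ (to (ker i j) ∘ suc-injective) (cong suc ∘ from (ker i j))

module _ {m r} {E : Rel (Fin m) r} (E? : Decidable E) where

  private
    collapse : Fin m → Fin m → Fin m → Fin m
    collapse u v w with w ≟ v
    ... | yes _ = u
    ... | no _ = w

    collapse-merges : ∀ u v → collapse u v u ≡ collapse u v v
    collapse-merges u v with u ≟ v | v ≟ v
    ... | _ | no v≢v = ⊥-elim (v≢v refl)
    ... | yes _ | yes _ = refl
    ... | no _ | yes _ = refl

    collapse-kernel : ∀ u v w w′ → collapse u v w ≡ collapse u v w′ →
      w ≡ w′ ⊎ (w ≡ u ⊎ w ≡ v) × (w′ ≡ u ⊎ w′ ≡ v)
    collapse-kernel u v w w′ e with w ≟ v | w′ ≟ v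
    ... | yes w≡v | yes w′≡v = inj₂ (inj₂ w≡v , inj₂ w′≡v)
    ... | yes w≡v | no _ = inj₂ (inj₂ w≡v , inj₁ (sym e))
    ... | no _ | yes w′≡v = inj₂ (inj₁ e , inj₂ w′≡v)
    ... | no _ | no _ = inj₁ e

    -- Union–find: each related pair in the list merges the labels of its two entries.
    merge : Fin m × Fin m → (Fin m → Fin m) → Fin m → Fin m
    merge (c , d) h with E? c d
    ... | yes _ = collapse (h c) (h d)
    ... | no _ = id

    label : List (Fin m × Fin m) → Fin m → Fin m
    label [] = id
    label (e ∷ L) = merge e (label L) ∘ label L

    label-respects : ∀ L {a b} → (a , b) ∈ₗ L → E a b → label L a ≡ label L b
    label-respects (e ∷ L) (there ab∈L) aEb = cong (merge e (label L)) (label-respects L ab∈L aEb)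
    label-respects ((a , b) ∷ L) (here refl) aEb with E? a b
    ... | yes _ = collapse-merges (label L a) (label L b)
    ... | no ¬aEb = ⊥-elim (¬aEb aEb)

    label-complete : ∀ L {a b} → label L a ≡ label L b → EqClosure E a b
    label-complete [] refl = ε
    label-complete ((c , d) ∷ L) {a} {b} e with E? c d
    ... | no _ = label-complete L e
    ... | yes cEd with collapse-kernel (label L c) (label L d) (label L a) (label L b) e
    ...   | inj₁ e′ = label-complete L e′
    ...   | inj₂ (a↦c , b↦c) = toC a↦c ◅◅ symmetric E (toC b↦c)
      where
      toC : ∀ {x} → label L x ≡ label L c ⊎ label L x ≡ label L d → EqClosure E x c
      toC (inj₁ x~c) = label-complete L x~c
      toC (inj₂ x~d) = label-complete L x~d ◅◅ symmetric E (return cEd)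

    allPairs : List (Fin m × Fin m)
    allPairs = cartesianProduct (allFin m) (allFin m)

  components : ∃₂ λ ℓ (p : Fin m → Fin ℓ) →
    (∀ c → ∃ λ i → p i ≡ c) × (∀ a b → p a ≡ p b ⇔ EqClosure E a b)
  components with coimage (label allPairs)
  ... | ℓ , p , onto , ker = ℓ , p , onto , λ a b → ⇔.trans (ker a b) (kernel a b)
    where
    kernel : ∀ a b → label allPairs a ≡ label allPairs b ⇔ EqClosure E a b
    kernel a b = mk⇔ (label-complete allPairs)
      (gfold isEquivalence (label allPairs)
        (label-respects allPairs (∈-cartesianProduct⁺ (∈-allFin _) (∈-allFin _))))

respects-eqClosure : ∀ {a r p} {A : Set a} {R : Rel A r} {P : A → Set p} →
  Symmetric R → P Respects R → P Respects EqClosure R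
respects-eqClosure {P = P} R-sym resp path =
  to (gfold ⇔.⇔-isEquivalence P (λ xRy → mk⇔ (resp xRy) (resp (R-sym xRy))) path)

module _ {n m : ℕ} (Γ : Pregeometry n m) where
  open Pregeometry Γ
  open ≡-Reasoning

  NonIncident : Rel (Fin m) 0ℓ
  NonIncident a b = ∃₂ λ x y → t x ≡ a × t y ≡ b × ¬ _*_ Γ x y

  incident? : ∀ x y → Dec (_*_ Γ x y)
  incident? x y = inc x y Bool.≟ true

  nonIncident? : Decidable NonIncident
  nonIncident? a b = any? λ x → any? λ y → (t x ≟ a) ×-dec (t y ≟ b) ×-dec ¬? (incident? x y)

  nonIncident-sym : Symmetric NonIncident
  nonIncident-sym (x , y , tx , ty , x≁y) = y , x , ty , tx , λ y*x → x≁y (trans (inc-sym x y) y*x)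

  IncidentAcross : ∀ {ℓ} → (Fin m → Fin ℓ) → Set
  IncidentAcross q = ∀ x y → q (t x) ≢ q (t y) → _*_ Γ x y

  nonIncident⇒sameSummand : ∀ {ℓ} {q : Fin m → Fin ℓ} → IncidentAcross q →
    ∀ {a b} → EqClosure NonIncident a b → q a ≡ q b
  nonIncident⇒sameSummand {q = q} across = gfold isEquivalence q sameSummand
    where
    sameSummand : ∀ {a b} → NonIncident a b → q a ≡ q b
    sameSummand (x , y , refl , refl , x≁y) = decidable-stable (q (t x) ≟ q (t y)) (x≁y ∘ across x y)

  incidentAcross-components : ∀ {ℓ} {p : Fin m → Fin ℓ} →
    (∀ a b → p a ≡ p b ⇔ EqClosure NonIncident a b) → IncidentAcross p
  incidentAcross-components ker x y px≢py = decidable-stable (incident? x y) λ x≁y →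
    px≢py (from (ker (t x) (t y)) (return (x , y , refl , refl , x≁y)))

  components-indecomposable : ∀ {ℓ} {p : Fin m → Fin ℓ} →
    (∀ a b → p a ≡ p b ⇔ EqClosure NonIncident a b) → ∀ k → Indecomposable Γ (λ i → p i ≡ k)
  components-indecomposable {p = p} ker k (A , (i , pi≡k , i∈A) , (j , pj≡k , j∉A) , across) =
    j∉A (respects-eqClosure nonIncident-sym stays-in-A (to (ker i j) (trans pi≡k (sym pj≡k)))
           (λ _ → i∈A) pj≡k)
    where
    stays-in-A : (λ a → p a ≡ k → a ∈ A) Respects NonIncident
    stays-in-A {a} {b} ab@(x , y , refl , refl , x≁y) a∈A pb≡k with b ∈? A
    ... | yes b∈A = b∈A
    ... | no b∉A = ⊥-elim (x≁y (across x y pa≡k pb≡k (a∈A pa≡k) b∉A))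
      where
      pa≡k : p a ≡ k
      pa≡k = trans (from (ker a b) (return ab)) pb≡k

  indecomposable⇒sameSummand : ∀ {J : Fin m → Set} {ℓ} {q : Fin m → Fin ℓ} →
    Indecomposable Γ J → IncidentAcross q → ∀ {i j} → J i → J j → q i ≡ q j
  indecomposable⇒sameSummand {J} {q = q} indecomposable across {i} {j} Ji Jj =
    decidable-stable (q i ≟ q j) λ qi≢qj →
      indecomposable (subset sameAsI? , (i , Ji , from (∈-subset sameAsI?) refl) ,
                          (j , Jj , qi≢qj ∘ sym ∘ to (∈-subset sameAsI?)) , across′)
    where
    sameAsI? : U.Decidable (λ a → q a ≡ q i)
    sameAsI? a = q a ≟ q i
    across′ : ∀ x y → J (t x) → J (t y) →
      t x ∈ subset sameAsI? → t y ∉ subset sameAsI? → _*_ Γ x y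
    across′ x y _ _ x∈A y∉A =
      across x y λ e → y∉A (from (∈-subset sameAsI?) (trans (sym e) (to (∈-subset sameAsI?) x∈A)))

  SameNeighbours : Fin m → Fin n → Fin n → Set
  SameNeighbours a v v′ = ∀ w → t w ≡ a → inc v w ≡ inc v′ w

  sameNeighbours? : ∀ a v v′ → Dec (SameNeighbours a v v′)
  sameNeighbours? a v v′ = all? λ w → (t w ≟ a) →-dec (inc v w Bool.≟ inc v′ w)

  sameNeighbours-sym : ∀ {a v v′} → SameNeighbours a v v′ → SameNeighbours a v′ v
  sameNeighbours-sym s w tw = sym (s w tw)

  sameNeighbours-trans : ∀ {a v v′ v″} →
    SameNeighbours a v v′ → SameNeighbours a v′ v″ → SameNeighbours a v v″
  sameNeighbours-trans s s′ w tw = trans (s w tw) (s′ w tw)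

  automorphism-preserves-sameNeighbours : ∀ {g a v v′} → IsAutomorphism Γ g →
    SameNeighbours a v v′ ⇔ SameNeighbours a (g ⟨$⟩ʳ v) (g ⟨$⟩ʳ v′)
  automorphism-preserves-sameNeighbours {g} {a} {v} {v′} (type-preserving , incidence-preserving) =
    mk⇔ forward backward
    where
    forward : SameNeighbours a v v′ → SameNeighbours a (g ⟨$⟩ʳ v) (g ⟨$⟩ʳ v′)
    forward s w tw = begin
      inc (g ⟨$⟩ʳ v) w               ≡⟨ cong (inc (g ⟨$⟩ʳ v)) (sym (inverseʳ g)) ⟩
      inc (g ⟨$⟩ʳ v) (g ⟨$⟩ʳ w′)     ≡⟨ incidence-preserving v w′ ⟩
      inc v w′                       ≡⟨ s w′ tw′ ⟩
      inc v′ w′                      ≡⟨ incidence-preserving v′ w′ ⟨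
      inc (g ⟨$⟩ʳ v′) (g ⟨$⟩ʳ w′)    ≡⟨ cong (inc (g ⟨$⟩ʳ v′)) (inverseʳ g) ⟩
      inc (g ⟨$⟩ʳ v′) w              ∎
      where
      w′ = g ⟨$⟩ˡ w
      tw′ : t w′ ≡ a
      tw′ = trans (sym (type-preserving w′)) (trans (cong t (inverseʳ g)) tw)
    backward : SameNeighbours a (g ⟨$⟩ʳ v) (g ⟨$⟩ʳ v′) → SameNeighbours a v v′
    backward s w tw = begin
      inc v w                        ≡⟨ incidence-preserving v w ⟨
      inc (g ⟨$⟩ʳ v) (g ⟨$⟩ʳ w)      ≡⟨ s (g ⟨$⟩ʳ w) (trans (type-preserving w) tw) ⟩
      inc (g ⟨$⟩ʳ v′) (g ⟨$⟩ʳ w)     ≡⟨ incidence-preserving v′ w ⟩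
      inc v′ w                       ∎

  nonIncident⇒neighboursDiffer : AllRank2Connected Γ → ∀ {a b} → a ≢ b → NonIncident a b →
    ¬ (∀ v v′ → t v ≡ b → t v′ ≡ b → SameNeighbours a v v′)
  nonIncident⇒neighboursDiffer connected {a} {b} a≢b (x₀ , y₀ , tx₀ , ty₀ , x₀≁y₀) alike =
    firstStep (connected b a (a≢b ∘ sym) x₀ y₀ (inj₂ tx₀) (inj₁ ty₀))
    where
    firstStep : Walk Γ b a x₀ y₀ → ⊥
    firstStep here = a≢b (trans (sym tx₀) ty₀)
    firstStep (step {y = y} x₀*y _ (inj₁ ty) _) = x₀≁y₀ (begin
      inc x₀ y₀   ≡⟨ inc-sym x₀ y₀ ⟩
      inc y₀ x₀   ≡⟨ alike y₀ y ty₀ ty x₀ tx₀ ⟩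
      inc y x₀    ≡⟨ inc-sym y x₀ ⟩
      inc x₀ y    ≡⟨ x₀*y ⟩
      true        ∎)
    firstStep (step _ tx₀≢ty (inj₂ ty) _) = tx₀≢ty (trans tx₀ (sym ty))

  inNeighbourClass? : ∀ b a u → U.Decidable λ v → t v ≡ b × SameNeighbours a v u
  inNeighbourClass? b a u v = (t v ≟ b) ×-dec sameNeighbours? a v u

  neighbourClass : Fin m → Fin m → Fin n → Subset n
  neighbourClass b a u = subset (inNeighbourClass? b a u)

  ∈-neighbourClass : ∀ {a b u v} → v ∈ neighbourClass b a u ⇔ (t v ≡ b × SameNeighbours a v u)
  ∈-neighbourClass {a} {b} {u} = ∈-subset (inNeighbourClass? b a u)

  FixesType : Permutation′ n → Fin m → Set
  FixesType g a = ∀ x → t x ≡ a → g ⟨$⟩ʳ x ≡ x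

  module _ {G : Permutation′ n → Set} (G≤Aut : IsAutSubgroup Γ G) where
    open IsAutSubgroup G≤Aut

    neighbourClass-isBlock : ∀ {a b u} → t u ≡ b → IsBlock Γ G b (neighbourClass b a u)
    neighbourClass-isBlock {a} {b} {u} tu =
      (λ _ → proj₁ ∘ to ∈-neighbourClass) , (u , from ∈-neighbourClass (tu , λ _ _ → refl)) ,
      invariantOrDisjoint
      where
      preserves : ∀ {g v v′} → G g →
        SameNeighbours a v v′ ⇔ SameNeighbours a (g ⟨$⟩ʳ v) (g ⟨$⟩ʳ v′)
      preserves {g} g∈G = automorphism-preserves-sameNeighbours {g} (aut g g∈G)

      invariantOrDisjoint : ∀ g → G g →
        (∀ x → (x ∈ neighbourClass b a u ⇔ g ⟨$⟩ʳ x ∈ neighbourClass b a u)) ⊎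
        (∀ x → x ∈ neighbourClass b a u → g ⟨$⟩ʳ x ∉ neighbourClass b a u)
      invariantOrDisjoint g g∈G with sameNeighbours? a (g ⟨$⟩ʳ u) u
      ... | yes gu~u = inj₁ λ x → mk⇔
        (λ x∈ → let tx , x~u = to ∈-neighbourClass x∈ in
          from ∈-neighbourClass (trans (proj₁ (aut g g∈G) x) tx ,
                                 sameNeighbours-trans (to (preserves g∈G) x~u) gu~u))
        (λ gx∈ → let tgx , gx~u = to ∈-neighbourClass gx∈ in
          from ∈-neighbourClass (trans (sym (proj₁ (aut g g∈G) x)) tgx ,
                                 from (preserves g∈G) (sameNeighbours-trans gx~u (sameNeighbours-sym gu~u))))
      ... | no gu≁u = inj₂ λ x x∈ gx∈ →
        gu≁u (sameNeighbours-trans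
               (sameNeighbours-sym (to (preserves g∈G) (proj₂ (to ∈-neighbourClass x∈))))
               (proj₂ (to ∈-neighbourClass gx∈)))


    fixing-propagates : AllRank2Connected Γ → PrimitiveBasic Γ G → ∀ {g} → IsAutomorphism Γ g →
      FixesType g Respects NonIncident
    fixing-propagates connected primitiveBasic {g} (type-preserving , incidence-preserving)
                      {a} {b} nonInc fixesA with a ≟ b
    ... | yes refl = fixesA
    ... | no a≢b = λ u tu →
      [ (λ singleton → singleton _ _ (from ∈-neighbourClass (trans (type-preserving u) tu , gu~u u))
                                     (from ∈-neighbourClass (tu , λ _ _ → refl)))
      , (λ whole → ⊥-elim (nonIncident⇒neighboursDiffer connected a≢b nonInc λ v v′ tv tv′ →
           sameNeighbours-trans (proj₂ (to ∈-neighbourClass (whole v tv)))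
                   (sameNeighbours-sym (proj₂ (to ∈-neighbourClass (whole v′ tv′))))))
      ]′ (proj₂ (proj₂ (primitiveBasic b)) _ (neighbourClass-isBlock {a} {b} {u} tu))
      where
      gu~u : ∀ u → SameNeighbours a (g ⟨$⟩ʳ u) u
      gu~u u w tw = begin
        inc (g ⟨$⟩ʳ u) w             ≡⟨ cong (inc (g ⟨$⟩ʳ u)) (fixesA w tw) ⟨
        inc (g ⟨$⟩ʳ u) (g ⟨$⟩ʳ w)    ≡⟨ incidence-preserving u w ⟩
        inc u w                      ∎

theorem1p1 : ∀ {n m : ℕ} (Γ : Pregeometry n m) → AllRank2Connected Γ →
    (G : Permutation′ n → Set) → IsAutSubgroup Γ G →
    (∀ i → TransitiveOn Γ G i) → PrimitiveBasic Γ G →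
    ∃₂ λ (ℓ : ℕ) (p : Fin m → Fin ℓ) → GoodDecomposition Γ G ℓ p ×
    (∀ (ℓ′ : ℕ) (q : Fin m → Fin ℓ′) → GoodDecomposition Γ G ℓ′ q →
    ∀ i j → (p i ≡ p j ⇔ q i ≡ q j))
theorem1p1 Γ connected G G≤Aut _ primitiveBasic with components (nonIncident? Γ)
... | ℓ , p , onto , ker =
  ℓ , p , ((onto , incidentAcross-components Γ ker) , components-indecomposable Γ ker ,
           λ j → faithful j , proj₂ (primitiveBasic j)) , unique
  where
  open Pregeometry Γ using (t)
  open IsAutSubgroup G≤Aut
  faithful : ∀ j g → G g → FixesType Γ g j → ∀ y → p (t y) ≡ p j → g ⟨$⟩ʳ y ≡ y
  faithful j g g∈G fixesJ y py≡pj =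
    respects-eqClosure (nonIncident-sym Γ)
      (fixing-propagates Γ G≤Aut connected primitiveBasic {g} (aut g g∈G))
      (to (ker j _) (sym py≡pj)) fixesJ y refl
  unique : ∀ ℓ′ (q : Fin _ → Fin ℓ′) → GoodDecomposition Γ G ℓ′ q →
    ∀ i j → p i ≡ p j ⇔ q i ≡ q j
  unique ℓ′ q ((_ , acrossQ) , indecomposableQ , _) i j = mk⇔
    (nonIncident⇒sameSummand Γ acrossQ ∘ to (ker i j))
    (λ qi≡qj → indecomposable⇒sameSummand Γ (indecomposableQ (q i))
                 (incidentAcross-components Γ ker) refl (sym qi≡qj))
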